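{- If $G$ is a tree with $|V(G)|\ge 3$, then $\det(G)=\det'(G)$.
   Context: A vertex set $S$ is a vertex determining set if the only automorphism fixing every vertex of $S$ is the identity; $\det(G)$ is the minimum size of such a set. For a graph with at most one isolated vertex and no $K_2$ component, an edge set $T$ is an edge determining set if the only automorphism $\phi$ with $\{\phi(u),\phi(v)\}=\{u,v\}$ for all $\{u,v\}\in T$ is the identity; $\det'(G)$ is the minimum size of such a set. -}

module Defs where

open import Data.Nat using (ℕ; zero; suc; _<_; _≤_)
open import Data.Fin using (Fin; toℕ)
open import Data.Fin.Subset using (Subset; _∈_; ∣_∣)
open import Data.Bool using (Bool; true; false)
open import Data.Product using (Σ; _×_; _,_; ∃)
open import Data.Sum using (_⊎_)
open import Data.List using (List; []; _∷_; length)
import Data.List.Membership.Propositional as LM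
open import Data.List.Relation.Unary.All using (All)
open import Data.List.Relation.Unary.Unique.Propositional using (Unique)
open import Relation.Binary.PropositionalEquality using (_≡_)
open import Relation.Nullary using (¬_)

record Graph (n : ℕ) : Set where
  field
    adj   : Fin n → Fin n → Bool
    sym   : ∀ u v → adj u v ≡ adj v u
    irrefl : ∀ u → adj u u ≡ false
open Graph public

Adj : ∀ {n} → Graph n → Fin n → Fin n → Set
Adj G u v = adj G u v ≡ true

data Walk {n} (G : Graph n) : Fin n → Fin n → Set where
  here : ∀ {u} → Walk G u u
  step : ∀ {u w v} → Adj G u w → Walk G w v → Walk G u v

Connected : ∀ {n} → Graph n → Set
Connected G = ∀ u v → Walk G u v

ClosedChain : ∀ {n} → Graph n → Fin n → Fin n → List (Fin n) → Set
ClosedChain G first x []       = Adj G x first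
ClosedChain G first x (y ∷ ys) = Adj G x y × ClosedChain G first y ys

IsCycle : ∀ {n} → Graph n → List (Fin n) → Set
IsCycle G []       = Data.Empty.⊥
  where import Data.Empty
IsCycle G (v ∷ vs) = Unique (v ∷ vs) × (3 ≤ length (v ∷ vs)) × ClosedChain G v v vs

Acyclic : ∀ {n} → Graph n → Set
Acyclic G = ∀ cs → ¬ IsCycle G cs

IsTree : ∀ {n} → Graph n → Set
IsTree G = Connected G × Acyclic G

record Automorphism {n} (G : Graph n) : Set where
  field
    fun  : Fin n → Fin n
    inv  : Fin n → Fin n
    invˡ : ∀ x → inv (fun x) ≡ x
    invʳ : ∀ x → fun (inv x) ≡ x
    pres : ∀ u v → adj G (fun u) (fun v) ≡ adj G u v
open Automorphism public

IsIdentity : ∀ {n} {G : Graph n} → Automorphism G → Set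
IsIdentity φ = ∀ x → fun φ x ≡ x

IsDetSet : ∀ {n} → Graph n → Subset n → Set
IsDetSet G S = (φ : Automorphism G) → (∀ x → x ∈ S → fun φ x ≡ x) → IsIdentity φ

IsDet : ∀ {n} → Graph n → ℕ → Set
IsDet G k = Σ _ (λ S → IsDetSet G S × ∣ S ∣ ≡ k)
          × (∀ S → IsDetSet G S → k ≤ ∣ S ∣)

-- An edge set: a duplicate-free list of edges, each edge {u,v} written once
-- as the pair (u , v) with u < v.
IsEdgeSet : ∀ {n} → Graph n → List (Fin n × Fin n) → Set
IsEdgeSet G T = Unique T × All (λ { (u , v) → (toℕ u < toℕ v) × Adj G u v }) T

FixesEdge : ∀ {n} {G : Graph n} → Automorphism G → Fin n × Fin n → Set
FixesEdge φ (u , v) = (fun φ u ≡ u × fun φ v ≡ v) ⊎ (fun φ u ≡ v × fun φ v ≡ u)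

IsEdgeDetSet : ∀ {n} → Graph n → List (Fin n × Fin n) → Set
IsEdgeDetSet G T = (φ : Automorphism G) → (∀ e → e LM.∈ T → FixesEdge φ e) → IsIdentity φ

IsEdgeDet : ∀ {n} → Graph n → ℕ → Set
IsEdgeDet G k = Σ _ (λ T → IsEdgeSet G T × IsEdgeDetSet G T × length T ≡ k)
              × (∀ T → IsEdgeSet G T → IsEdgeDetSet G T → k ≤ length T)

-- An automorphism of a tree fixing a vertex r preserves distances to r.  So if it also fixes a
-- vertex x, it fixes the unique neighbour of x closer to r; and if it fixes setwise the edge from
-- x towards r, it fixes x.  Hence a determining set {r, s, x₃, …} gives an edge determining set
-- of the same size: the edges from s, x₃, … towards r and one further edge preventing r from
-- moving.  Conversely, given an edge determining set, let p be the end of the first edge away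
-- from the second one, and keep p together with the end away from p of every other edge; each
-- discarded end is then the neighbour of a kept vertex towards another kept vertex.  The cases of
-- a single vertex or a single edge compare branch sizes: an automorphism swapping the ends of an
-- edge ab makes both components of T − ab equally large, whereas one fixing a and moving b makes
-- the component of a the larger one.

module Submission where

open import Defs hiding (sym)
open import Data.Nat using (ℕ; zero; suc; _≤_; _<_; _+_; z≤n; s≤s; s≤s⁻¹)
open import Data.Nat.Properties
  using ( ≤-refl; ≤-reflexive; ≤-trans; ≤-antisym; <-irrefl; <-asym; <-cmp; _<?_; ≮⇒≥; <⇒≱; ≤∧≢⇒<
        ; n≤1+n; m≤m+n; n≤0⇒n≡0; n≮0; n≢0⇒n>0; 1+n≰n; 1+n≢n; 0≢1+n; m≢1+n+m; suc-injective
        ; m≤n⇒m<n∨m≡n; +-identityʳ; +-suc; +-monoˡ-≤; _≟_; module ≤-Reasoning )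
open import Data.Fin using (Fin; toℕ) renaming (zero to fzero; suc to fsuc)
open import Data.Fin.Properties using (any?; all?; toℕ-injective) renaming (_≟_ to _≟ᶠ_)
open import Data.Fin.Subset using (Subset; ∣_∣; ⊤; ⁅_⁆) renaming (_∈_ to _∈ˢ_)
open import Data.Fin.Subset.Properties using (_∈?_; drop-there; anySubset?; ∈⊤; ∣⊤∣≡n; x∈⁅x⁆; ∣⁅x⁆∣≡1)
open import Data.Bool using (true; false)
import Data.Bool.Properties as Bool
open import Data.Product using (Σ; ∃; ∃-syntax; _×_; _,_; proj₁; proj₂)
open import Data.Product.Properties using (≡-dec)
open import Data.Sum using (_⊎_; inj₁; inj₂; [_,_]′)
import Data.Sum as Sum
open import Data.Empty using (⊥; ⊥-elim)
open import Data.List using (List; []; _∷_; _++_; length; filter; map; allFin; tabulate; deduplicate)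
open import Data.List.Properties using (filter-notAll; length-map; length-tabulate)
open import Data.List.Relation.Unary.All using (All; []; _∷_)
import Data.List.Relation.Unary.All as All
open import Data.List.Relation.Unary.All.Properties using (¬Any⇒All¬; ++⁺)
open import Data.List.Relation.Unary.Any using (here; there)
import Data.List.Relation.Unary.Any as Any
open import Data.List.Relation.Unary.AllPairs using ([]; _∷_)
open import Data.List.Relation.Unary.Unique.Propositional using (Unique)
import Data.List.Relation.Unary.Unique.Propositional.Properties as Unique
import Data.List.Relation.Unary.Unique.DecPropositional.Properties as UniqueDec
open import Data.List.Membership.Propositional using (_∈_)
open import Data.List.Membership.Propositional.Properties
  using (∈-filter⁺; ∈-filter⁻; ∈-map⁺; ∈-map⁻; ∈-allFin; ∈-deduplicate⁺; ∈-deduplicate⁻)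
import Data.List.Membership.DecPropositional as DecMembership
open import Data.List.Relation.Binary.Subset.Propositional using (_⊆_)
open import Data.Vec using (Vec; []; _∷_; here; there)
import Data.Vec as Vec
open import Data.Vec.Properties using (lookup∘tabulate; lookup⇒[]=; []=⇒lookup)
open import Function using (case_of_; _∘_)
open import Level using (0ℓ)
open import Relation.Nullary using (Dec; yes; no; ¬_; ¬?; does; contradiction)
open import Relation.Nullary.Decidable using (_×-dec_; _⊎-dec_; _→-dec_; decidable-stable)
open import Relation.Unary using (Pred; Decidable)
open import Relation.Binary.Definitions using (DecidableEquality; tri<; tri≈; tri>)
open import Relation.Binary.PropositionalEquality

-- Least witnesses, counting, and subsets of Fin n

Least : (ℕ → Set) → ℕ → Set
Least P k = P k × (∀ j → P j → k ≤ j)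

module _ {P : ℕ → Set} (P? : Decidable P) where

  private
    least-below : ∀ m → (∀ j → j < m → ¬ P j) ⊎ ∃ (Least P)
    least-below zero = inj₁ λ _ ()
    least-below (suc m) with least-below m
    ... | inj₂ found = inj₂ found
    ... | inj₁ none with P? m
    ...   | yes pm = inj₂ (m , pm , λ j pj → ≮⇒≥ λ j<m → none j j<m pj)
    ...   | no ¬pm = inj₁ none′
      where
      none′ : ∀ j → j < suc m → ¬ P j
      none′ j j<1+m with m≤n⇒m<n∨m≡n (s≤s⁻¹ j<1+m)
      ... | inj₁ j<m = none j j<m
      ... | inj₂ refl = ¬pm

  least : ∀ {m} → P m → ∃ (Least P)
  least {m} pm with least-below (suc m)
  ... | inj₁ none = ⊥-elim (none m ≤-refl pm)
  ... | inj₂ found = found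

Unique-⊆⇒length≤ : ∀ {A : Set} → DecidableEquality A →
                   ∀ {xs ys : List A} → Unique xs → xs ⊆ ys → length xs ≤ length ys
Unique-⊆⇒length≤ _≟_ {[]} _ _ = z≤n
Unique-⊆⇒length≤ _≟_ {x ∷ xs} {ys} (x∉xs ∷ xs!) xs⊆ys =
  ≤-trans (s≤s (Unique-⊆⇒length≤ _≟_ xs! xs⊆ys-x)) (filter-notAll ≢x? ys x∈ys)
  where
  ≢x? : Decidable (x ≢_)
  ≢x? y = ¬? (x ≟ y)
  x∈ys = Any.map (λ x≡y x≢y → x≢y x≡y) (xs⊆ys (here refl))
  xs⊆ys-x : xs ⊆ filter ≢x? ys
  xs⊆ys-x y∈xs = ∈-filter⁺ ≢x? (xs⊆ys (there y∈xs)) (All.lookup x∉xs y∈xs)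

module _ {n : ℕ} where

  count : {P : Pred (Fin n) 0ℓ} → Decidable P → ℕ
  count P? = length (filter P? (allFin n))

  private
    Unique-filter-allFin : {P : Pred (Fin n) 0ℓ} (P? : Decidable P) → Unique (filter P? (allFin n))
    Unique-filter-allFin P? = Unique.filter⁺ P? (Unique.allFin⁺ n)

    ∈-filter-allFin⁻ : {P : Pred (Fin n) 0ℓ} (P? : Decidable P) → ∀ {x} → x ∈ filter P? (allFin n) → P x
    ∈-filter-allFin⁻ P? x∈ = proj₂ (∈-filter⁻ P? {xs = allFin n} x∈)

    ∈-filter-allFin⁺ : {P : Pred (Fin n) 0ℓ} (P? : Decidable P) → ∀ {x} → P x → x ∈ filter P? (allFin n)
    ∈-filter-allFin⁺ P? {x} = ∈-filter⁺ P? (∈-allFin x)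

  count-mono-injective : {P Q : Pred (Fin n) 0ℓ} (P? : Decidable P) (Q? : Decidable Q) (f : Fin n → Fin n) →
                         (∀ {a b} → f a ≡ f b → a ≡ b) → (∀ {v} → P v → Q (f v)) → count P? ≤ count Q?
  count-mono-injective P? Q? f f-inj P⇒Qf =
    subst (_≤ count Q?) (length-map f (filter P? (allFin n)))
      (Unique-⊆⇒length≤ _≟ᶠ_ (Unique.map⁺ f-inj (Unique-filter-allFin P?)) image⊆)
    where
    image⊆ : map f (filter P? (allFin n)) ⊆ filter Q? (allFin n)
    image⊆ y∈ with ∈-map⁻ f y∈
    ... | x , x∈ , refl = ∈-filter-allFin⁺ Q? (P⇒Qf (∈-filter-allFin⁻ P? x∈))

  count-mono-< : {P Q : Pred (Fin n) 0ℓ} (P? : Decidable P) (Q? : Decidable Q) →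
                 (∀ {v} → P v → Q v) → ∀ {a} → Q a → ¬ P a → count P? < count Q?
  count-mono-< P? Q? P⇒Q {a} qa ¬pa =
    Unique-⊆⇒length≤ _≟ᶠ_ (a∉ ∷ Unique-filter-allFin P?) a∷P⊆Q
    where
    a∉ : All (a ≢_) (filter P? (allFin n))
    a∉ = All.tabulate λ x∈ a≡x → ¬pa (subst _ (sym a≡x) (∈-filter-allFin⁻ P? x∈))
    a∷P⊆Q : (a ∷ filter P? (allFin n)) ⊆ filter Q? (allFin n)
    a∷P⊆Q (here refl) = ∈-filter-allFin⁺ Q? qa
    a∷P⊆Q (there x∈) = ∈-filter-allFin⁺ Q? (P⇒Q (∈-filter-allFin⁻ P? x∈))

  elements : Subset n → List (Fin n)
  elements S = filter (_∈? S) (allFin n)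

  elements-unique : ∀ S → Unique (elements S)
  elements-unique S = Unique-filter-allFin (_∈? S)

  ∈-elements⁺ : ∀ {S x} → x ∈ˢ S → x ∈ elements S
  ∈-elements⁺ {S} = ∈-filter-allFin⁺ (_∈? S)

  ∈-elements⁻ : ∀ {S x} → x ∈ elements S → x ∈ˢ S
  ∈-elements⁻ {S} = ∈-filter-allFin⁻ (_∈? S)

private
  length-filter-tabulate : ∀ {m k} (S : Subset k) (T : Subset m) (h : Fin k → Fin m) →
    (∀ {i} → h i ∈ˢ T → i ∈ˢ S) → (∀ {i} → i ∈ˢ S → h i ∈ˢ T) →
    length (filter (_∈? T) (tabulate h)) ≡ ∣ S ∣
  length-filter-tabulate [] T h _ _ = refl
  length-filter-tabulate (b ∷ S) T h to from with h fzero ∈? T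
  length-filter-tabulate (true ∷ S) T h to from | yes _ =
    cong suc (length-filter-tabulate S T (λ i → h (fsuc i)) (drop-there ∘ to) (from ∘ there))
  length-filter-tabulate (false ∷ S) T h to from | yes h0∈T with to h0∈T
  ... | ()
  length-filter-tabulate (true ∷ S) T h to from | no h0∉T = ⊥-elim (h0∉T (from here))
  length-filter-tabulate (false ∷ S) T h to from | no _ =
    length-filter-tabulate S T (λ i → h (fsuc i)) (drop-there ∘ to) (from ∘ there)

length-elements : ∀ {n} (S : Subset n) → length (elements S) ≡ ∣ S ∣
length-elements S = length-filter-tabulate S S (λ i → i) (λ i∈ → i∈) (λ i∈ → i∈)

∣S∣≤length : ∀ {n} {S : Subset n} {xs : List (Fin n)} → (∀ {x} → x ∈ˢ S → x ∈ xs) → ∣ S ∣ ≤ length xs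
∣S∣≤length {S = S} S⊆xs = subst (_≤ _) (length-elements S)
  (Unique-⊆⇒length≤ _≟ᶠ_ (elements-unique S) (λ x∈ → S⊆xs (∈-elements⁻ x∈)))

module _ {n : ℕ} where
  open DecMembership (_≟ᶠ_ {n}) using () renaming (_∈?_ to _∈ᴸ?_)

  fromList : List (Fin n) → Subset n
  fromList xs = Vec.tabulate λ i → does (i ∈ᴸ? xs)

  ∈-fromList⁺ : ∀ {xs x} → x ∈ xs → x ∈ˢ fromList xs
  ∈-fromList⁺ {xs} {x} x∈xs = lookup⇒[]= x (fromList xs) (trans (lookup∘tabulate _ x) member)
    where
    member : does (x ∈ᴸ? xs) ≡ true
    member with x ∈ᴸ? xs
    ... | yes _ = refl
    ... | no x∉xs = ⊥-elim (x∉xs x∈xs)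

  ∈-fromList⁻ : ∀ {xs x} → x ∈ˢ fromList xs → x ∈ xs
  ∈-fromList⁻ {xs} {x} x∈ = member (trans (sym (lookup∘tabulate _ x)) ([]=⇒lookup x∈))
    where
    member : does (x ∈ᴸ? xs) ≡ true → x ∈ xs
    member eq with x ∈ᴸ? xs
    ... | yes x∈xs = x∈xs
    member () | no _

  ∣fromList∣≤length : ∀ xs → ∣ fromList xs ∣ ≤ length xs
  ∣fromList∣≤length xs = ∣S∣≤length (∈-fromList⁻ {xs})

module _ {A : Set} (∃A? : ∀ {P : Pred A 0ℓ} → Decidable P → Dec (∃ P)) where

  ∃Vec? : ∀ m {P : Pred (Vec A m) 0ℓ} → Decidable P → Dec (∃ P)
  ∃Vec? zero P? with P? []
  ... | yes p = yes ([] , p)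
  ... | no ¬p = no λ { ([] , p) → ¬p p }
  ∃Vec? (suc m) P? with ∃A? (λ a → ∃Vec? m (λ v → P? (a ∷ v)))
  ... | yes (a , v , p) = yes (a ∷ v , p)
  ... | no ¬p = no λ { (a ∷ v , p) → ¬p (a , v , p) }

third-element : ∀ {n} → 3 ≤ n → (a b : Fin n) → ∃[ z ] z ≢ a × z ≢ b
third-element {n} 3≤n a b with any? (λ z → ¬? (z ≟ᶠ a) ×-dec ¬? (z ≟ᶠ b))
... | yes found = found
... | no none = ⊥-elim (<⇒≱ 3≤n (subst (_≤ 2) (length-tabulate (λ i → i))
                         (Unique-⊆⇒length≤ _≟ᶠ_ (Unique.allFin⁺ n) ⊆ab)))
  where
  ⊆ab : allFin n ⊆ (a ∷ b ∷ [])
  ⊆ab {z} _ with z ≟ᶠ a | z ≟ᶠ b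
  ... | yes refl | _ = here refl
  ... | no _ | yes refl = there (here refl)
  ... | no z≢a | no z≢b = ⊥-elim (none (z , z≢a , z≢b))

-- Walks and automorphisms

NonTrivial : ∀ {n} {G : Graph n} → Automorphism G → Set
NonTrivial φ = ∃[ x ] fun φ x ≢ x

FixesPair : ∀ {n} → (Fin n → Fin n) → Fin n → Fin n → Set
FixesPair f u v = (f u ≡ u × f v ≡ v) ⊎ (f u ≡ v × f v ≡ u)

fixesPair? : ∀ {n} (f : Fin n → Fin n) u v → Dec (FixesPair f u v)
fixesPair? f u v = ((f u ≟ᶠ u) ×-dec (f v ≟ᶠ v)) ⊎-dec ((f u ≟ᶠ v) ×-dec (f v ≟ᶠ u))

FixesPair-swap : ∀ {n} {f : Fin n → Fin n} {u v} → FixesPair f u v → FixesPair f v u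
FixesPair-swap (inj₁ (fu , fv)) = inj₁ (fv , fu)
FixesPair-swap (inj₂ (fu , fv)) = inj₂ (fv , fu)

FixesPair-resp : ∀ {n} {f g : Fin n → Fin n} → (∀ x → f x ≡ g x) → ∀ {u v} → FixesPair f u v → FixesPair g u v
FixesPair-resp f≗g (inj₁ (fu , fv)) = inj₁ (trans (sym (f≗g _)) fu , trans (sym (f≗g _)) fv)
FixesPair-resp f≗g (inj₂ (fu , fv)) = inj₂ (trans (sym (f≗g _)) fu , trans (sym (f≗g _)) fv)

module GraphProperties {n : ℕ} (G : Graph n) where

  adj? : ∀ u v → Dec (Adj G u v)
  adj? u v = adj G u v Bool.≟ true

  adj-sym : ∀ {u v} → Adj G u v → Adj G v u
  adj-sym {u} {v} = trans (Graph.sym G v u)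

  adj-irrefl : ∀ {u} → ¬ Adj G u u
  adj-irrefl {u} uu with trans (sym (irrefl G u)) uu
  ... | ()

  adj⇒≢ : ∀ {u v} → Adj G u v → u ≢ v
  adj⇒≢ uv refl = adj-irrefl uv

  steps : ∀ {u v} → Walk G u v → ℕ
  steps here = 0
  steps (step _ w) = suc (steps w)

  _▷_ : ∀ {u v x} → Walk G u v → Adj G v x → Walk G u x
  here ▷ vx = step vx here
  step uw w ▷ vx = step uw (w ▷ vx)

  steps-▷ : ∀ {u v x} (w : Walk G u v) (vx : Adj G v x) → steps (w ▷ vx) ≡ suc (steps w)
  steps-▷ here vx = refl
  steps-▷ (step _ w) vx = cong suc (steps-▷ w vx)

  reverse : ∀ {u v} → Walk G u v → Walk G v u
  reverse here = here
  reverse (step uw w) = reverse w ▷ adj-sym uw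

  steps-reverse : ∀ {u v} (w : Walk G u v) → steps (reverse w) ≡ steps w
  steps-reverse here = refl
  steps-reverse (step uw w) = trans (steps-▷ (reverse w) (adj-sym uw)) (cong suc (steps-reverse w))

  _++ʷ_ : ∀ {u v x} → Walk G u v → Walk G v x → Walk G u x
  here ++ʷ w′ = w′
  step uw w ++ʷ w′ = step uw (w ++ʷ w′)

  WalkWithin : ℕ → Fin n → Fin n → Set
  WalkWithin k u v = Σ (Walk G u v) λ w → steps w ≤ k

  walkWithin? : ∀ k u v → Dec (WalkWithin k u v)
  walkWithin? k u v with u ≟ᶠ v
  ... | yes refl = yes (here , z≤n)
  walkWithin? zero u v | no u≢v = no λ { (here , _) → u≢v refl ; (step _ _ , ()) }
  walkWithin? (suc k) u v | no u≢v with any? (λ x → adj? u x ×-dec walkWithin? k x v)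
  ... | yes (x , ux , w , w≤k) = yes (step ux w , s≤s w≤k)
  ... | no ¬first = no λ { (here , _) → u≢v refl
                         ; (step {w = x} ux w , s≤s w≤k) → ¬first (x , ux , w , w≤k) }

  OnWalk : (Fin n → Set) → ∀ {u v} → Walk G u v → Set
  OnWalk P {u} here = P u
  OnWalk P {u} (step _ w) = P u × OnWalk P w

  OnWalk-++ : ∀ {P u v x} (w : Walk G u v) (w′ : Walk G v x) → OnWalk P w → OnWalk P w′ → OnWalk P (w ++ʷ w′)
  OnWalk-++ here w′ _ pw′ = pw′
  OnWalk-++ (step _ w) w′ (pu , pw) pw′ = pu , OnWalk-++ w w′ pw pw′

  Chain : Fin n → List (Fin n) → Fin n → Set
  Chain x [] b = x ≡ b
  Chain x (y ∷ ys) b = Adj G x y × Chain y ys b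

  Path : (Fin n → Set) → Fin n → Fin n → Set
  Path P a b = Σ (List (Fin n)) λ zs → Chain a zs b × Unique (a ∷ zs) × All P (a ∷ zs)

  path-from-member : ∀ {P a x b} zs → Chain x zs b → Unique (x ∷ zs) → All P (x ∷ zs) → a ∈ (x ∷ zs) → Path P a b
  path-from-member zs ch ! all (here refl) = zs , ch , ! , all
  path-from-member [] ch ! all (there ())
  path-from-member (y ∷ ys) (_ , ch) (_ ∷ !) (_ ∷ all) (there a∈) = path-from-member ys ch ! all a∈

  -- loop erasure
  walk⇒path : ∀ {P a b} (w : Walk G a b) → OnWalk P w → Path P a b
  walk⇒path here pa = [] , refl , [] ∷ [] , pa ∷ []
  walk⇒path {a = a} (step {w = c} ac w) (pa , pw) with walk⇒path w pw
  ... | zs , ch , ! , all with Any.any? (a ≟ᶠ_) (c ∷ zs)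
  ...   | yes a∈ = path-from-member zs ch ! all a∈
  ...   | no a∉ = c ∷ zs , (ac , ch) , ¬Any⇒All¬ (c ∷ zs) a∉ ∷ ! , pa ∷ all

  chain⇒closedChain : ∀ {first x b} zs → Chain x zs b → Adj G b first → ClosedChain G first x zs
  chain⇒closedChain [] refl e = e
  chain⇒closedChain (y ∷ ys) (e′ , ch) e = e′ , chain⇒closedChain ys ch e

  chain-∷ʳ⇒closedChain : ∀ {first x b c} zs → Chain x zs b → Adj G b c → Adj G c first →
                         ClosedChain G first x (zs ++ c ∷ [])
  chain-∷ʳ⇒closedChain [] refl bc cf = bc , cf
  chain-∷ʳ⇒closedChain (y ∷ ys) (e , ch) bc cf = e , chain-∷ʳ⇒closedChain ys ch bc cf

  module _ (f : Fin n → Fin n) (f-adj : ∀ {a b} → Adj G a b → Adj G (f a) (f b)) where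

    map-walk : ∀ {u v} → Walk G u v → Walk G (f u) (f v)
    map-walk here = here
    map-walk (step uw w) = step (f-adj uw) (map-walk w)

    steps-map-walk : ∀ {u v} (w : Walk G u v) → steps (map-walk w) ≡ steps w
    steps-map-walk here = refl
    steps-map-walk (step _ w) = cong suc (steps-map-walk w)

  module _ (φ : Automorphism G) where

    adj-fun : ∀ {a b} → Adj G a b → Adj G (fun φ a) (fun φ b)
    adj-fun {a} {b} = trans (pres φ a b)

    adj-inv : ∀ {a b} → Adj G a b → Adj G (inv φ a) (inv φ b)
    adj-inv {a} {b} = trans (subst₂ (λ x y → adj G (inv φ a) (inv φ b) ≡ adj G x y)
                                    (invʳ φ a) (invʳ φ b) (sym (pres φ (inv φ a) (inv φ b))))

    fun-injective : ∀ {a b} → fun φ a ≡ fun φ b → a ≡ b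
    fun-injective {a} {b} eq = trans (sym (invˡ φ a)) (trans (cong (inv φ) eq) (invˡ φ b))

  -- Automorphisms are found by enumerating tables for fun and inv, so Q must respect
  -- pointwise equality.
  module _ (Q : (Fin n → Fin n) → Set) (Q? : ∀ f → Dec (Q f))
           (Q-ext : ∀ f g → (∀ x → f x ≡ g x) → Q f → Q g) where

    private
      IsCandidate : (Fin n → Fin n) → (Fin n → Fin n) → Set
      IsCandidate f g = (∀ x → g (f x) ≡ x) × (∀ x → f (g x) ≡ x) ×
                        (∀ u v → adj G (f u) (f v) ≡ adj G u v) × Q f × ∃[ x ] f x ≢ x

      isCandidate? : ∀ f g → Dec (IsCandidate f g)
      isCandidate? f g = all? (λ x → g (f x) ≟ᶠ x) ×-dec all? (λ x → f (g x) ≟ᶠ x) ×-dec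
                         all? (λ u → all? λ v → adj G (f u) (f v) Bool.≟ adj G u v) ×-dec
                         Q? f ×-dec any? (λ x → ¬? (f x ≟ᶠ x))

      tables : (φ : Automorphism G) → Q (fun φ) → NonTrivial φ →
               ∃[ f ] ∃[ g ] IsCandidate (Vec.lookup f) (Vec.lookup g)
      tables φ qφ (x , φx≢x) = F , F⁻¹ ,
          (λ y → trans (cong (Vec.lookup F⁻¹) (F≗ y)) (trans (F⁻¹≗ (fun φ y)) (invˡ φ y))) ,
          (λ y → trans (cong (Vec.lookup F) (F⁻¹≗ y)) (trans (F≗ (inv φ y)) (invʳ φ y))) ,
          (λ u v → trans (cong₂ (adj G) (F≗ u) (F≗ v)) (pres φ u v)) ,
          Q-ext (fun φ) (Vec.lookup F) (λ y → sym (F≗ y)) qφ ,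
          x , λ eq → φx≢x (trans (sym (F≗ x)) eq)
        where
        F = Vec.tabulate (fun φ)
        F⁻¹ = Vec.tabulate (inv φ)
        F≗ = lookup∘tabulate (fun φ)
        F⁻¹≗ = lookup∘tabulate (inv φ)

    nontrivial? : Dec (Σ (Automorphism G) λ φ → Q (fun φ) × NonTrivial φ)
    nontrivial? with ∃Vec? any? n (λ f → ∃Vec? any? n (λ g → isCandidate? (Vec.lookup f) (Vec.lookup g)))
    ... | yes (f , g , gf , fg , f-pres , qf , moved) =
      yes (record { fun = Vec.lookup f ; inv = Vec.lookup g ; invˡ = gf ; invʳ = fg ; pres = f-pres } , qf , moved)
    ... | no ¬tables = no λ (φ , qφ , moved) → ¬tables (tables φ qφ moved)

    identity-or-nontrivial : (∀ (φ : Automorphism G) → Q (fun φ) → IsIdentity φ) ⊎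
                             Σ (Automorphism G) λ φ → Q (fun φ) × NonTrivial φ
    identity-or-nontrivial with nontrivial?
    ... | yes counterexample = inj₂ counterexample
    ... | no ¬counterexample = inj₁ λ φ qφ x →
            decidable-stable (fun φ x ≟ᶠ x) λ φx≢x → ¬counterexample (φ , qφ , x , φx≢x)

  detSet-or-counterexample : ∀ S → IsDetSet G S ⊎
    Σ (Automorphism G) λ φ → (∀ x → x ∈ˢ S → fun φ x ≡ x) × NonTrivial φ
  detSet-or-counterexample S = identity-or-nontrivial (λ f → ∀ x → x ∈ˢ S → f x ≡ x)
    (λ f → all? λ x → (x ∈? S) →-dec (f x ≟ᶠ x))
    (λ f g f≗g fixes x x∈S → trans (sym (f≗g x)) (fixes x x∈S))

  isDetSet? : ∀ S → Dec (IsDetSet G S)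
  isDetSet? S with detSet-or-counterexample S
  ... | inj₁ det = yes det
  ... | inj₂ (φ , fixes , x , φx≢x) = no λ det → φx≢x (det φ fixes x)

  edgeDetSet-or-counterexample : ∀ T → IsEdgeDetSet G T ⊎
    Σ (Automorphism G) λ φ → (∀ e → e ∈ T → FixesEdge φ e) × NonTrivial φ
  edgeDetSet-or-counterexample T
    with identity-or-nontrivial (λ f → All (λ (u , v) → FixesPair f u v) T)
           (λ f → All.all? (λ (u , v) → fixesPair? f u v) T)
           (λ f g f≗g → All.map (FixesPair-resp f≗g))
  ... | inj₁ identity = inj₁ λ φ fixes → identity φ (All.tabulate (fixes _))
  ... | inj₂ (φ , fixes , nontrivial) = inj₂ (φ , (λ _ → All.lookup fixes) , nontrivial)

minimum-detSet : ∀ {n} (G : Graph n) → ∃[ S ] IsDetSet G S × (∀ S′ → IsDetSet G S′ → ∣ S ∣ ≤ ∣ S′ ∣)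
minimum-detSet {n} G with least (λ k → anySubset? λ S → isDetSet? S ×-dec (∣ S ∣ ≟ k))
                                (⊤ , (λ φ fixes x → fixes x ∈⊤) , ∣⊤∣≡n n)
  where open GraphProperties G
... | _ , (S , S-det , refl) , minimal = S , S-det , λ S′ S′-det → minimal _ (S′ , S′-det , refl)

-- Distances in connected graphs

module Distance {n : ℕ} {G : Graph n} (connected : Connected G) where

  open GraphProperties G

  private
    shortest : ∀ u v → ∃ (Least λ k → WalkWithin k u v)
    shortest u v = least (λ k → walkWithin? k u v) (connected u v , ≤-refl)

  abstract
    dist : Fin n → Fin n → ℕ
    dist u v = proj₁ (shortest u v)

    dist-walk : ∀ u v → WalkWithin (dist u v) u v
    dist-walk u v = proj₁ (proj₂ (shortest u v))

    dist-minimal : ∀ {u v} (w : Walk G u v) → dist u v ≤ steps w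
    dist-minimal {u} {v} w = proj₂ (proj₂ (shortest u v)) (steps w) (w , ≤-refl)

  dist-self : ∀ u → dist u u ≡ 0
  dist-self u = n≤0⇒n≡0 (dist-minimal {u} here)

  dist≡0⇒≡ : ∀ {u v} → dist u v ≡ 0 → u ≡ v
  dist≡0⇒≡ {u} {v} eq with dist-walk u v
  ... | here , _ = refl
  ... | step _ _ , w≤ with subst (suc _ ≤_) eq w≤
  ...   | ()

  dist-adj : ∀ {u v x} → Adj G v x → dist u x ≤ suc (dist u v)
  dist-adj {u} {v} {x} e with dist-walk u v
  ... | w , w≤ = begin
    dist u x        ≤⟨ dist-minimal (w ▷ e) ⟩
    steps (w ▷ e)   ≡⟨ steps-▷ w e ⟩
    suc (steps w)   ≤⟨ s≤s w≤ ⟩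
    suc (dist u v)  ∎
    where open ≤-Reasoning

  dist-sym : ∀ u v → dist u v ≡ dist v u
  dist-sym u v = ≤-antisym (sym≤ v u) (sym≤ u v)
    where
    sym≤ : ∀ u v → dist v u ≤ dist u v
    sym≤ u v with dist-walk u v
    ... | w , w≤ = ≤-trans (dist-minimal (reverse w)) (subst (_≤ dist u v) (sym (steps-reverse w)) w≤)

  closer-neighbour : ∀ {u v m} → dist u v ≡ suc m → ∃[ p ] Adj G v p × dist u p ≡ m
  closer-neighbour {u} {v} {m} eq with dist-walk v u
  ... | here , _ = ⊥-elim (0≢1+n (trans (sym (dist-self u)) eq))
  ... | step {w = p} vp rest , rest≤ = p , vp , ≤-antisym upper lower
    where
    upper : dist u p ≤ m
    upper = begin
      dist u p    ≡⟨ dist-sym u p ⟩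
      dist p u    ≤⟨ dist-minimal rest ⟩
      steps rest  ≤⟨ s≤s⁻¹ (subst (suc (steps rest) ≤_) (trans (dist-sym v u) eq) rest≤) ⟩
      m           ∎
      where open ≤-Reasoning
    lower : m ≤ dist u p
    lower = s≤s⁻¹ (subst (_≤ suc (dist u p)) eq (dist-adj (adj-sym vp)))

  dist-map-walk : (f : Fin n → Fin n) (f-adj : ∀ {a b} → Adj G a b → Adj G (f a) (f b)) →
                  ∀ u v → dist (f u) (f v) ≤ dist u v
  dist-map-walk f f-adj u v with dist-walk u v
  ... | w , w≤ = ≤-trans (dist-minimal (map-walk f f-adj w))
                         (subst (_≤ dist u v) (sym (steps-map-walk f f-adj w)) w≤)

  dist-fun : (φ : Automorphism G) → ∀ u v → dist (fun φ u) (fun φ v) ≡ dist u v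
  dist-fun φ u v = ≤-antisym (dist-map-walk (fun φ) (adj-fun φ) u v)
    (subst₂ (λ x y → dist x y ≤ dist (fun φ u) (fun φ v)) (invˡ φ u) (invˡ φ v)
            (dist-map-walk (inv φ) (adj-inv φ) (fun φ u) (fun φ v)))

  OnWalk-dist-to : ∀ M {a r} (w : Walk G a r) → steps w ≤ M → OnWalk (λ z → dist r z ≤ M) w
  OnWalk-dist-to M {r = r} here _ = subst (_≤ M) (sym (dist-self r)) z≤n
  OnWalk-dist-to M {a} {r} (step e w) w≤ =
    ≤-trans (≤-reflexive (dist-sym r a)) (≤-trans (dist-minimal (step e w)) w≤) ,
    OnWalk-dist-to M w (≤-trans (n≤1+n _) w≤)

  OnWalk-dist-from : ∀ r M {a b} (w : Walk G a b) → dist r a + steps w ≤ M → OnWalk (λ z → dist r z ≤ M) w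
  OnWalk-dist-from r M here ≤M = subst (_≤ M) (+-identityʳ _) ≤M
  OnWalk-dist-from r M (step e w) ≤M = ≤-trans (m≤m+n _ _) ≤M ,
    OnWalk-dist-from r M w (≤-trans (+-monoˡ-≤ (steps w) (dist-adj e)) (subst (_≤ M) (+-suc _ _) ≤M))

  level-path : ∀ r m {y₁ y₂} → dist r y₁ ≡ m → dist r y₂ ≡ m → Path (λ z → dist r z ≤ m) y₁ y₂
  level-path r m {y₁} {y₂} d₁ d₂ with dist-walk y₁ r | dist-walk r y₂
  ... | w₁ , w₁≤ | w₂ , w₂≤ = walk⇒path (w₁ ++ʷ w₂) (OnWalk-++ w₁ w₂ low₁ low₂)
    where
    low₁ = OnWalk-dist-to m w₁ (subst (steps w₁ ≤_) (trans (dist-sym y₁ r) d₁) w₁≤)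
    low₂ = OnWalk-dist-from r m w₂ (subst (_≤ m) (sym (cong (_+ steps w₂) (dist-self r))) (subst (steps w₂ ≤_) d₂ w₂≤))

  parent-spec : ∀ r x → Σ (Fin n) λ p → x ≢ r → Adj G x p × suc (dist r p) ≡ dist r x
  parent-spec r x with dist r x in d
  ... | zero = x , λ x≢r → ⊥-elim (x≢r (sym (dist≡0⇒≡ d)))
  ... | suc m with closer-neighbour d
  ...   | p , xp , dp = p , λ _ → xp , cong suc dp

  parent : Fin n → Fin n → Fin n
  parent r x = proj₁ (parent-spec r x)

  parent-adj : ∀ {r x} → x ≢ r → Adj G x (parent r x)
  parent-adj {r} {x} x≢r = proj₁ (proj₂ (parent-spec r x) x≢r)

  parent-dist : ∀ {r x} → x ≢ r → suc (dist r (parent r x)) ≡ dist r x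
  parent-dist {r} {x} x≢r = proj₂ (proj₂ (parent-spec r x) x≢r)

  fixes-via-parent : ∀ (φ : Automorphism G) {r x} → x ≢ r → fun φ r ≡ r → FixesPair (fun φ) x (parent r x) → fun φ x ≡ x
  fixes-via-parent φ _ _ (inj₁ (φx , _)) = φx
  fixes-via-parent φ {r} {x} x≢r φr (inj₂ (φx≡p , _)) =
    ⊥-elim (1+n≢n (trans (parent-dist x≢r) (trans (sym (dist-fun φ r x)) (cong₂ dist φr φx≡p))))

-- Trees

module TreeProperties {n : ℕ} {G : Graph n} (connected : Connected G) (acyclic : Acyclic G) where

  open GraphProperties G
  open Distance connected

  closer-neighbour-unique : ∀ r {v y₁ y₂} → Adj G v y₁ → Adj G v y₂ →
                            suc (dist r y₁) ≡ dist r v → suc (dist r y₂) ≡ dist r v → y₁ ≡ y₂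
  closer-neighbour-unique r {v} {y₁} {y₂} vy₁ vy₂ d₁ d₂ with y₁ ≟ᶠ y₂
  ... | yes y₁≡y₂ = y₁≡y₂
  ... | no y₁≢y₂ with level-path r (dist r y₁) refl (suc-injective (trans d₂ (sym d₁)))
  ...   | [] , refl , _ = ⊥-elim (y₁≢y₂ refl)
  ...   | zs@(_ ∷ _) , ch , ! , low = ⊥-elim (acyclic (v ∷ y₁ ∷ zs)
          (v∉ ∷ ! , s≤s (s≤s (s≤s z≤n)) , vy₁ , chain⇒closedChain zs ch (adj-sym vy₂)))
    where
    v∉ : All (v ≢_) (y₁ ∷ zs)
    v∉ = All.map (λ z≤ v≡z → 1+n≰n (subst (_≤ dist r y₁) (trans (cong (dist r) (sym v≡z)) (sym d₁)) z≤)) low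

  adj⇒dist≢ : ∀ r {u w} → Adj G u w → dist r u ≢ dist r w
  adj⇒dist≢ r {u} {w} uw eq with dist r u in du
  ... | zero = adj⇒≢ uw (trans (sym (dist≡0⇒≡ du)) (dist≡0⇒≡ (sym eq)))
  ... | suc m with closer-neighbour du | closer-neighbour (sym eq)
  ...   | pu , u-pu , dpu | pw , w-pw , dpw with level-path r m dpu dpw
  ...     | zs , ch , ! , low = acyclic (u ∷ pu ∷ zs ++ w ∷ [])
            (u∉ ∷ Unique.++⁺ ! ([] ∷ []) (λ { (z∈ , here refl) → All.lookup w∉ z∈ refl }) , length≥3 zs , u-pu ,
             chain-∷ʳ⇒closedChain zs ch (adj-sym w-pw) (adj-sym uw))
    where
    above : ∀ {x} → dist r x ≡ suc m → ∀ {z} → dist r z ≤ m → x ≢ z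
    above dx z≤ refl = 1+n≰n (subst (_≤ m) dx z≤)
    w∉ : All (_≢ w) (pu ∷ zs)
    w∉ = All.map (λ z≤ z≡w → above (sym eq) z≤ (sym z≡w)) low
    u∉ : All (u ≢_) ((pu ∷ zs) ++ w ∷ [])
    u∉ = ++⁺ (All.map (above du) low) (adj⇒≢ uw ∷ [])
    length≥3 : ∀ zs → 3 ≤ length (u ∷ pu ∷ zs ++ w ∷ [])
    length≥3 [] = s≤s (s≤s (s≤s z≤n))
    length≥3 (_ ∷ _) = s≤s (s≤s (s≤s z≤n))

  fixes-closer-neighbour : ∀ (φ : Automorphism G) {r x y} → fun φ r ≡ r → fun φ x ≡ x →
                           Adj G x y → dist r y < dist r x → fun φ y ≡ y
  fixes-closer-neighbour φ {r} {x} {y} φr φx xy y<x = sym (closer-neighbour-unique r xy xφy d d′)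
    where
    xφy : Adj G x (fun φ y)
    xφy = subst (λ z → Adj G z (fun φ y)) φx (adj-fun φ xy)
    d : suc (dist r y) ≡ dist r x
    d = ≤-antisym y<x (dist-adj (adj-sym xy))
    d′ : suc (dist r (fun φ y)) ≡ dist r x
    d′ = trans (cong (λ z → suc (dist z (fun φ y))) (sym φr)) (trans (cong suc (dist-fun φ r y)) d)

module Branches {n : ℕ} {G : Graph n} (connected : Connected G) (acyclic : Acyclic G) where

  open GraphProperties G
  open Distance connected
  open TreeProperties connected acyclic

  -- For an edge ab of a tree, Closer a b is the component of a in G − ab.
  Closer : Fin n → Fin n → Fin n → Set
  Closer a b v = dist v a < dist v b

  closer? : ∀ a b v → Dec (Closer a b v)
  closer? a b v = dist v a <? dist v b

  branch : Fin n → Fin n → ℕ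
  branch a b = count (closer? a b)

  closer-self : ∀ {a b} → Adj G a b → Closer a b a
  closer-self {a} {b} ab = subst (_< dist a b) (sym (dist-self a))
    (n≢0⇒n>0 λ d≡0 → adj⇒≢ ab (dist≡0⇒≡ d≡0))

  ¬closer-self : ∀ {a b} → ¬ Closer b a a
  ¬closer-self {a} {b} b<a = n≮0 (subst (dist a b <_) (dist-self a) b<a)

  closer-across : ∀ {x y₁ y₂ v} → Adj G x y₁ → Adj G x y₂ → y₁ ≢ y₂ → Closer y₂ x v → Closer x y₁ v
  closer-across {x} {y₁} {y₂} {v} xy₁ xy₂ y₁≢y₂ y₂<x with <-cmp (dist v x) (dist v y₁)
  ... | tri< x<y₁ _ _ = x<y₁
  ... | tri≈ _ x≡y₁ _ = ⊥-elim (adj⇒dist≢ v xy₁ x≡y₁)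
  ... | tri> _ _ y₁<x = ⊥-elim (y₁≢y₂ (closer-neighbour-unique v xy₁ xy₂
          (≤-antisym y₁<x (dist-adj (adj-sym xy₁))) (≤-antisym y₂<x (dist-adj (adj-sym xy₂)))))

  Closer-fun : ∀ (φ : Automorphism G) {a b v} → Closer a b v → Closer (fun φ a) (fun φ b) (fun φ v)
  Closer-fun φ {a} {b} {v} = subst₂ _<_ (sym (dist-fun φ v a)) (sym (dist-fun φ v b))

  branch-swap : ∀ (φ : Automorphism G) {a b} → fun φ a ≡ b → fun φ b ≡ a → branch a b ≤ branch b a
  branch-swap φ {a} {b} φa φb = count-mono-injective (closer? a b) (closer? b a) (fun φ) (fun-injective φ)
    λ a<b → subst₂ (λ x y → Closer x y _) φa φb (Closer-fun φ a<b)

  branch-< : ∀ {x y₁ y₂} → Adj G x y₁ → Adj G x y₂ → y₁ ≢ y₂ → branch y₂ x < branch x y₁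
  branch-< {x} xy₁ xy₂ y₁≢y₂ =
    count-mono-< (closer? _ x) (closer? x _) (closer-across xy₁ xy₂ y₁≢y₂) (closer-self xy₁) ¬closer-self

  branch-fixed : ∀ (φ : Automorphism G) {a b} → Adj G a b → fun φ a ≡ a → fun φ b ≢ b → branch b a < branch a b
  branch-fixed φ {a} {b} ab φa φb≢b = begin-strict
    branch b a                          ≤⟨ count-mono-injective (closer? b a) Closer-a-but-not-a? (fun φ) (fun-injective φ) image ⟩
    count Closer-a-but-not-a?           <⟨ count-mono-< Closer-a-but-not-a? (closer? a b) proj₁ (closer-self ab) (λ (_ , a≢a) → a≢a refl) ⟩
    branch a b                          ∎
    where
    open ≤-Reasoning
    Closer-a-but-not-a? : ∀ v → Dec (Closer a b v × v ≢ a)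
    Closer-a-but-not-a? v = closer? a b v ×-dec ¬? (v ≟ᶠ a)
    aφb : Adj G a (fun φ b)
    aφb = subst (λ z → Adj G z (fun φ b)) φa (adj-fun φ ab)
    image : ∀ {v} → Closer b a v → Closer a b (fun φ v) × fun φ v ≢ a
    image b<a = closer-across ab aφb (λ b≡φb → φb≢b (sym b≡φb)) (subst (λ z → Closer _ z _) φa (Closer-fun φ b<a)) ,
                λ φv≡a → ¬closer-self (subst (Closer _ _) (fun-injective φ (trans φv≡a (sym φa))) b<a)

-- Edge sets and the two inequalities

module EdgeSets {n : ℕ} (G : Graph n) where

  open GraphProperties G

  orient : Fin n × Fin n → Fin n × Fin n
  orient (u , v) with toℕ u <? toℕ v
  ... | yes _ = u , v
  ... | no _ = v , u

  IsEdge : Fin n × Fin n → Set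
  IsEdge (u , v) = toℕ u < toℕ v × Adj G u v

  orient-isEdge : ∀ {u v} → Adj G u v → IsEdge (orient (u , v))
  orient-isEdge {u} {v} uv with toℕ u <? toℕ v
  ... | yes u<v = u<v , uv
  ... | no u≮v = ≤∧≢⇒< (≮⇒≥ u≮v) (λ v≡u → adj⇒≢ uv (toℕ-injective (sym v≡u))) , adj-sym uv

  FixesPair-orient : ∀ {f u v} → FixesPair f (proj₁ (orient (u , v))) (proj₂ (orient (u , v))) → FixesPair f u v
  FixesPair-orient {f} {u} {v} fixes with toℕ u <? toℕ v
  ... | yes _ = fixes
  ... | no _ = FixesPair-swap fixes

  edgeSet : List (Fin n × Fin n) → List (Fin n × Fin n)
  edgeSet es = deduplicate (≡-dec _≟ᶠ_ _≟ᶠ_) (map orient es)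

  edgeSet-isEdgeSet : ∀ es → (∀ {u v} → (u , v) ∈ es → Adj G u v) → IsEdgeSet G (edgeSet es)
  edgeSet-isEdgeSet es adj-es = UniqueDec.deduplicate-! _ (map orient es) , All.tabulate isEdge
    where
    isEdge : ∀ {e} → e ∈ edgeSet es → IsEdge e
    isEdge e∈ with ∈-map⁻ orient (∈-deduplicate⁻ _ (map orient es) e∈)
    ... | _ , uv∈ , refl = orient-isEdge (adj-es uv∈)

  length-edgeSet : ∀ es → length (edgeSet es) ≤ length es
  length-edgeSet es = subst (length (edgeSet es) ≤_) (length-map orient es)
    (Unique-⊆⇒length≤ (≡-dec _≟ᶠ_ _≟ᶠ_) (UniqueDec.deduplicate-! _ (map orient es)) (∈-deduplicate⁻ _ (map orient es)))

  fixes-edgeSet : ∀ {es} (φ : Automorphism G) → (∀ e → e ∈ edgeSet es → FixesEdge φ e) →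
                  ∀ {u v} → (u , v) ∈ es → FixesPair (fun φ) u v
  fixes-edgeSet φ fixes uv∈ = FixesPair-orient (fixes _ (∈-deduplicate⁺ _ (∈-map⁺ orient uv∈)))

  edgeSet-adj : ∀ {T} → IsEdgeSet G T → ∀ {u v} → (u , v) ∈ T → Adj G u v
  edgeSet-adj (_ , isEdges) uv∈ = proj₂ (All.lookup isEdges uv∈)

module DeterminingSets {n : ℕ} {G : Graph n} (connected : Connected G) (acyclic : Acyclic G) where

  open GraphProperties G
  open Distance connected
  open TreeProperties connected acyclic
  open Branches connected acyclic
  open EdgeSets G

  away : Fin n → Fin n × Fin n → Fin n × Fin n
  away r (a , b) with dist r a <? dist r b
  ... | yes _ = b , a
  ... | no _ = a , b

  AwayFrom : Fin n → Fin n × Fin n → Set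
  AwayFrom r (x , y) = Adj G x y × dist r y < dist r x

  SameEdge : Fin n × Fin n → Fin n × Fin n → Set
  SameEdge (x , y) (a , b) = (x ≡ a × y ≡ b) ⊎ (x ≡ b × y ≡ a)

  away-spec : ∀ r {a b} → Adj G a b → AwayFrom r (away r (a , b)) × SameEdge (away r (a , b)) (a , b)
  away-spec r {a} {b} ab with dist r a <? dist r b
  ... | yes a<b = (adj-sym ab , a<b) , inj₂ (refl , refl)
  ... | no a≮b = (ab , ≤∧≢⇒< (≮⇒≥ a≮b) (λ b≡a → adj⇒dist≢ r ab (sym b≡a))) , inj₁ (refl , refl)

  FixesPair-sameEdge : ∀ {f x y a b} → SameEdge (x , y) (a , b) → f x ≡ x → f y ≡ y → FixesPair f a b
  FixesPair-sameEdge (inj₁ (refl , refl)) fx fy = inj₁ (fx , fy)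
  FixesPair-sameEdge (inj₂ (refl , refl)) fx fy = inj₁ (fy , fx)

  away-away : ∀ {p p′ q q′ x} → dist x p′ < dist x p → Adj G q q′ → dist p q′ < dist p q →
              x ≡ q ⊎ x ≡ q′ → dist q p′ < dist q p
  away-away p′<p _ _ (inj₁ refl) = p′<p
  away-away {p} {p′} {q} {q′} p′<p qq′ q′<q (inj₂ refl) = begin-strict
    dist q p′         ≡⟨ dist-sym q p′ ⟩
    dist p′ q         ≤⟨ dist-adj (adj-sym qq′) ⟩
    suc (dist p′ q′)  ≡⟨ cong suc (dist-sym p′ q′) ⟩
    suc (dist q′ p′)  ≤⟨ p′<p ⟩
    dist q′ p         ≡⟨ dist-sym q′ p ⟩
    dist p q′         <⟨ q′<q ⟩
    dist p q          ≡⟨ dist-sym p q ⟩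
    dist q p          ∎
    where open ≤-Reasoning

  detSet-one-edge : ∀ {a b} → Adj G a b → IsEdgeDetSet G ((a , b) ∷ []) → IsDetSet G ⁅ a ⁆ ⊎ IsDetSet G ⁅ b ⁆
  detSet-one-edge {a} {b} ab ab-det with detSet-or-counterexample ⁅ a ⁆ | detSet-or-counterexample ⁅ b ⁆
  ... | inj₁ det | _ = inj₁ det
  ... | inj₂ _ | inj₁ det = inj₂ det
  ... | inj₂ (φ , fixes-a , φ-moves) | inj₂ (ψ , fixes-b , ψ-moves) =
    ⊥-elim (<-asym (branch-fixed φ ab φa φb≢b) (branch-fixed ψ (adj-sym ab) ψb ψa≢a))
    where
    φa = fixes-a a (x∈⁅x⁆ a)
    ψb = fixes-b b (x∈⁅x⁆ b)
    φb≢b : fun φ b ≢ b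
    φb≢b φb = proj₂ φ-moves (ab-det φ (λ { _ (here refl) → inj₁ (φa , φb) ; _ (there ()) }) (proj₁ φ-moves))
    ψa≢a : fun ψ a ≢ a
    ψa≢a ψa = proj₂ ψ-moves (ab-det ψ (λ { _ (here refl) → inj₁ (ψa , ψb) ; _ (there ()) }) (proj₁ ψ-moves))

  detSet-two-edges : ∀ {a₁ b₁ a₂ b₂} rest → (∀ {u v} → (u , v) ∈ (a₁ , b₁) ∷ (a₂ , b₂) ∷ rest → Adj G u v) →
                     IsEdgeDetSet G ((a₁ , b₁) ∷ (a₂ , b₂) ∷ rest) →
                     ∃[ S ] IsDetSet G S × ∣ S ∣ ≤ 2 + length rest
  detSet-two-edges {a₁} {b₁} {a₂} {b₂} rest adj-T T-det
    with away a₂ (a₁ , b₁) | away-spec a₂ (adj-T (here refl))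
  ... | p , p′ | (pp′ , p′<p) , same₁ with away p (a₂ , b₂) | away-spec p (adj-T (there (here refl)))
  ...   | q , q′ | (qq′ , q′<q) , same₂ = S , S-det ,
          subst (∣ S ∣ ≤_) (cong (2 +_) (length-map far-end rest)) (∣fromList∣≤length ends)
    where
    far-end : Fin n × Fin n → Fin n
    far-end e = proj₁ (away p e)
    ends = p ∷ q ∷ map far-end rest
    S = fromList ends
    a₂∈q-edge : a₂ ≡ q ⊎ a₂ ≡ q′
    a₂∈q-edge = Sum.map (sym ∘ proj₁) (sym ∘ proj₂) same₂
    S-det : IsDetSet G S
    S-det φ fixes = T-det φ fixes-T
      where
      φp = fixes p (∈-fromList⁺ {xs = ends} (here refl))
      φq = fixes q (∈-fromList⁺ {xs = ends} (there (here refl)))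
      φq′ = fixes-closer-neighbour φ φp φq qq′ q′<q
      φp′ = fixes-closer-neighbour φ φq φp pp′ (away-away p′<p qq′ q′<q a₂∈q-edge)
      fixes-rest : ∀ {u v} → (u , v) ∈ rest → FixesPair (fun φ) u v
      fixes-rest {u} {v} uv∈ with away p (u , v) | away-spec p (adj-T (there (there uv∈)))
                                | fixes (far-end (u , v)) (∈-fromList⁺ {xs = ends} (there (there (∈-map⁺ far-end uv∈))))
      ... | x , y | (xy , y<x) , same | φx = FixesPair-sameEdge same φx (fixes-closer-neighbour φ φp φx xy y<x)
      fixes-T : ∀ e → e ∈ (a₁ , b₁) ∷ (a₂ , b₂) ∷ rest → FixesEdge φ e
      fixes-T _ (here refl) = FixesPair-sameEdge same₁ φp φp′
      fixes-T _ (there (here refl)) = FixesPair-sameEdge same₂ φq φq′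
      fixes-T _ (there (there uv∈)) = fixes-rest uv∈

  detSet≤edgeDetSet : ∀ T → IsEdgeSet G T → IsEdgeDetSet G T → ∃[ S ] IsDetSet G S × ∣ S ∣ ≤ length T
  detSet≤edgeDetSet [] _ T-det = fromList [] , (λ φ _ → T-det φ λ _ ()) , ∣fromList∣≤length {n} []
  detSet≤edgeDetSet ((a , b) ∷ []) T-set T-det with detSet-one-edge (edgeSet-adj T-set (here refl)) T-det
  ... | inj₁ det = ⁅ a ⁆ , det , ≤-reflexive (∣⁅x⁆∣≡1 a)
  ... | inj₂ det = ⁅ b ⁆ , det , ≤-reflexive (∣⁅x⁆∣≡1 b)
  detSet≤edgeDetSet (_ ∷ _ ∷ rest) T-set T-det = detSet-two-edges rest (edgeSet-adj T-set) T-det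

  module _ (3≤n : 3 ≤ n) where

    has-neighbour : ∀ r → ∃[ q ] Adj G r q
    has-neighbour r with third-element 3≤n r r
    ... | z , z≢r , _ with connected r z
    ...   | here = ⊥-elim (z≢r refl)
    ...   | step rq _ = _ , rq

    no-isolated-edge : ∀ {a b} → (∀ {y} → Adj G a y → y ≡ b) → (∀ {y} → Adj G b y → y ≡ a) → ⊥
    no-isolated-edge {a} {b} only-b only-a with third-element 3≤n a b
    ... | z , z≢a , z≢b = [ z≢a , z≢b ]′ (stays (connected a z) (inj₁ refl))
      where
      stays : ∀ {x y} → Walk G x y → x ≡ a ⊎ x ≡ b → y ≡ a ⊎ y ≡ b
      stays here x∈ab = x∈ab
      stays (step ay w) (inj₁ refl) = stays w (inj₂ (only-b ay))
      stays (step by w) (inj₂ refl) = stays w (inj₁ (only-a by))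

    edge-extends : ∀ a b → (∃[ c ] Adj G a c × c ≢ b) ⊎ (∃[ c ] Adj G b c × c ≢ a)
    edge-extends a b with any? (λ c → adj? a c ×-dec ¬? (c ≟ᶠ b)) | any? (λ c → adj? b c ×-dec ¬? (c ≟ᶠ a))
    ... | yes found | _ = inj₁ found
    ... | no _ | yes found = inj₂ found
    ... | no none-a | no none-b = ⊥-elim (no-isolated-edge (only none-a) (only none-b))
      where
      only : ∀ {x z} → ¬ (∃[ c ] Adj G x c × c ≢ z) → ∀ {y} → Adj G x y → y ≡ z
      only {z = z} none {y} xy = decidable-stable (y ≟ᶠ z) λ y≢z → none (y , xy , y≢z)

    swapped-unless-determining : ∀ {r} → (∀ (φ : Automorphism G) → fun φ r ≡ r → IsIdentity φ) → ∀ q →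
      IsEdgeDetSet G (edgeSet ((r , q) ∷ [])) ⊎ Σ (Automorphism G) λ φ → fun φ r ≡ q × fun φ q ≡ r
    swapped-unless-determining {r} r-det q with edgeDetSet-or-counterexample (edgeSet ((r , q) ∷ []))
    ... | inj₁ det = inj₁ det
    ... | inj₂ (φ , fixes , x , φx≢x) with fixes-edgeSet {(r , q) ∷ []} φ fixes (here refl)
    ...   | inj₁ (φr , _) = ⊥-elim (φx≢x (r-det φ φr x))
    ...   | inj₂ swap = inj₂ (φ , swap)

    other-neighbour : ∀ (φ : Automorphism G) {r q} → fun φ r ≡ q → fun φ q ≡ r → ∃[ c ] Adj G r c × c ≢ q
    other-neighbour φ {r} {q} φr φq with edge-extends r q
    ... | inj₁ found = found
    ... | inj₂ (c , qc , c≢r) = fun φ c , subst (λ z → Adj G z (fun φ c)) φq (adj-fun φ qc) ,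
                                λ φc≡q → c≢r (fun-injective φ (trans φc≡q (sym φr)))

    -- An automorphism swapping r and q makes the two branches at the edge rq equally large;
    -- this cannot happen at two distinct edges at r.
    determining-edge-at : ∀ r → (∀ (φ : Automorphism G) → fun φ r ≡ r → IsIdentity φ) →
                          ∃[ q ] Adj G r q × IsEdgeDetSet G (edgeSet ((r , q) ∷ []))
    determining-edge-at r r-det with has-neighbour r
    ... | q₁ , rq₁ with swapped-unless-determining r-det q₁
    ...   | inj₁ det = q₁ , rq₁ , det
    ...   | inj₂ (φ , φr , φq₁) with other-neighbour φ φr φq₁
    ...     | q₂ , rq₂ , q₂≢q₁ with swapped-unless-determining r-det q₂
    ...       | inj₁ det = q₂ , rq₂ , det
    ...       | inj₂ (ψ , ψr , ψq₂) = ⊥-elim (<-irrefl refl (begin-strict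
                  branch r q₁  ≤⟨ branch-swap φ φr φq₁ ⟩
                  branch q₁ r  <⟨ branch-< rq₂ rq₁ q₂≢q₁ ⟩
                  branch r q₂  ≤⟨ branch-swap ψ ψr ψq₂ ⟩
                  branch q₂ r  <⟨ branch-< rq₁ rq₂ (λ q₁≡q₂ → q₂≢q₁ (sym q₁≡q₂)) ⟩
                  branch r q₁  ∎))
      where open ≤-Reasoning

    RootingEdge : Fin n → Fin n → Fin n → Set
    RootingEdge r s t = ∃[ u ] ∃[ v ] Adj G u v ×
      (∀ (φ : Automorphism G) → FixesPair (fun φ) u v → FixesPair (fun φ) s t → fun φ r ≡ r)

    rooting-edge-adjacent : ∀ {r s} → Adj G s r → RootingEdge r s r
    rooting-edge-adjacent {r} {s} sr with edge-extends r s
    ... | inj₁ (c , rc , c≢s) = r , c , rc , λ where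
      φ (inj₁ (φr , _)) _ → φr
      φ _ (inj₁ (_ , φr)) → φr
      φ (inj₂ (φr≡c , _)) (inj₂ (_ , φr≡s)) → ⊥-elim (c≢s (trans (sym φr≡c) φr≡s))
    ... | inj₂ (c , sc , c≢r) = s , c , sc , λ where
      φ _ (inj₁ (_ , φr)) → φr
      φ (inj₁ (φs≡s , _)) (inj₂ (φs≡r , _)) → ⊥-elim (adj⇒≢ sr (trans (sym φs≡s) φs≡r))
      φ (inj₂ (φs≡c , _)) (inj₂ (φs≡r , _)) → ⊥-elim (c≢r (trans (sym φs≡c) φs≡r))

    -- r w is the first edge of the path from r to s; swapping r and w would bring s closer to r.
    rooting-edge-distant : ∀ {r s m} → dist r s ≡ suc (suc m) → RootingEdge r s (parent r s)
    rooting-edge-distant {r} {s} {m} d with closer-neighbour (trans (dist-sym s r) d)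
    ... | w , rw , dsw with closer-neighbour (trans (dist-sym w s) dsw)
    ...   | p , sp , dwp = r , w , rw , roots
      where
      s≢r : s ≢ r
      s≢r refl = 0≢1+n (trans (sym (dist-self r)) d)
      drp : dist r p ≡ suc m
      drp = ≤-antisym (begin
        dist r p        ≡⟨ dist-sym r p ⟩
        dist p r        ≤⟨ dist-adj (adj-sym rw) ⟩
        suc (dist p w)  ≡⟨ cong suc (trans (dist-sym p w) dwp) ⟩
        suc m           ∎)
        (s≤s⁻¹ (subst (_≤ suc (dist r p)) d (dist-adj (adj-sym sp))))
        where open ≤-Reasoning
      parent≡p : parent r s ≡ p
      parent≡p = closer-neighbour-unique r (parent-adj s≢r) sp (parent-dist s≢r) (trans (cong suc drp) (sym d))
      image : ∀ (φ : Automorphism G) {t} → fun φ r ≡ w → fun φ s ≡ t → dist w t ≡ suc (suc m)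
      image φ φr≡w φs≡t = trans (sym (cong₂ dist φr≡w φs≡t)) (trans (dist-fun φ r s) d)
      roots : ∀ (φ : Automorphism G) → FixesPair (fun φ) r w → FixesPair (fun φ) s (parent r s) → fun φ r ≡ r
      roots φ (inj₁ (φr , _)) _ = φr
      roots φ (inj₂ (φr≡w , _)) s-pair with subst (FixesPair (fun φ) s) parent≡p s-pair
      ... | inj₁ (φs≡s , _) = ⊥-elim (1+n≢n (trans (sym (image φ φr≡w φs≡s)) (trans (dist-sym w s) dsw)))
      ... | inj₂ (φs≡p , _) = ⊥-elim (m≢1+n+m m (trans (sym dwp) (image φ φr≡w φs≡p)))

    rooting-edge : ∀ {r s} → s ≢ r → RootingEdge r s (parent r s)
    rooting-edge {r} {s} s≢r = by-distance (dist r s) refl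
      where
      by-distance : ∀ k → dist r s ≡ k → RootingEdge r s (parent r s)
      by-distance zero d = ⊥-elim (s≢r (sym (dist≡0⇒≡ d)))
      by-distance (suc (suc m)) d = rooting-edge-distant d
      by-distance (suc zero) d = subst (RootingEdge r s) (sym parent≡r)
                                   (rooting-edge-adjacent (subst (Adj G s) parent≡r (parent-adj s≢r)))
        where
        parent≡r : parent r s ≡ r
        parent≡r = sym (dist≡0⇒≡ (suc-injective (trans (parent-dist s≢r) d)))

    edgeDetSet-rooted : ∀ {S} → IsDetSet G S → ∀ {r s rest} → All (r ≢_) (s ∷ rest) →
                        (∀ {x} → x ∈ˢ S → x ∈ r ∷ s ∷ rest) →
                        ∃[ T ] IsEdgeSet G T × IsEdgeDetSet G T × length T ≤ 2 + length rest
    edgeDetSet-rooted S-det {r} {s} {rest} r≢ S⊆ with rooting-edge (≢-sym (All.head r≢))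
    ... | u , v , uv , roots = edgeSet es , edgeSet-isEdgeSet es adj-es , determining ,
                               ≤-trans (length-edgeSet es) (≤-reflexive (cong (2 +_) (length-map _ rest)))
      where
      es = (u , v) ∷ map (λ x → x , parent r x) (s ∷ rest)
      adj-es : ∀ {a b} → (a , b) ∈ es → Adj G a b
      adj-es (here refl) = uv
      adj-es (there ab∈) with ∈-map⁻ _ ab∈
      ... | x , x∈ , refl = parent-adj (≢-sym (All.lookup r≢ x∈))
      determining : IsEdgeDetSet G (edgeSet es)
      determining φ fixes = S-det φ λ x x∈S → fixes-all (S⊆ x∈S)
        where
        fixes-es = fixes-edgeSet {es} φ fixes
        φr = roots φ (fixes-es (here refl)) (fixes-es (there (here refl)))
        fixes-all : ∀ {x} → x ∈ r ∷ s ∷ rest → fun φ x ≡ x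
        fixes-all (here refl) = φr
        fixes-all (there x∈) = fixes-via-parent φ (≢-sym (All.lookup r≢ x∈)) φr (fixes-es (there (∈-map⁺ _ x∈)))

    edgeDetSet≤detSet : ∀ S → IsDetSet G S → ∃[ T ] IsEdgeSet G T × IsEdgeDetSet G T × length T ≤ ∣ S ∣
    edgeDetSet≤detSet S S-det = from-elements (elements S) (elements-unique S) ∈-elements⁺ (length-elements S)
      where
      from-elements : ∀ xs → Unique xs → (∀ {x} → x ∈ˢ S → x ∈ xs) → length xs ≡ ∣ S ∣ →
                      ∃[ T ] IsEdgeSet G T × IsEdgeDetSet G T × length T ≤ ∣ S ∣
      from-elements [] _ S⊆ _ = [] , ([] , []) , (λ φ _ → S-det φ λ x x∈S → contradiction (S⊆ x∈S) λ ()) , z≤n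
      from-elements (r ∷ []) _ S⊆ len =
        let q , rq , det = determining-edge-at r λ φ φr → S-det φ λ x x∈S → case S⊆ x∈S of λ where
                             (here refl) → φr
                             (there ())
        in edgeSet ((r , q) ∷ []) , edgeSet-isEdgeSet ((r , q) ∷ []) (λ { (here refl) → rq ; (there ()) }) , det ,
           ≤-trans (length-edgeSet ((r , q) ∷ [])) (≤-reflexive len)
      from-elements (r ∷ s ∷ rest) (r∉ ∷ _) S⊆ len with edgeDetSet-rooted S-det r∉ S⊆
      ... | T , T-set , T-det , T≤ = T , T-set , T-det , subst (length T ≤_) len T≤

theorem10 : (n : ℕ) (G : Graph n) → IsTree G → 3 ≤ n →
    Σ ℕ (λ k → IsDet G k × IsEdgeDet G k)
theorem10 n G (connected , acyclic) 3≤n with minimum-detSet G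
... | S , S-det , S-min with DeterminingSets.edgeDetSet≤detSet connected acyclic 3≤n S S-det
...   | T , T-set , T-det , T≤S =
  ∣ S ∣ , ((S , S-det , refl) , S-min) , ((T , T-set , T-det , ≤-antisym T≤S (S≤ T T-set T-det)) , S≤)
  where
  open DeterminingSets connected acyclic
  S≤ : ∀ T′ → IsEdgeSet G T′ → IsEdgeDetSet G T′ → ∣ S ∣ ≤ length T′
  S≤ T′ T′-set T′-det with detSet≤edgeDetSet T′ T′-set T′-det
  ... | S′ , S′-det , S′≤T′ = ≤-trans (S-min S′ S′-det) S′≤T′
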